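{- Let $\mathcal{P}=(P,\leq^\mathcal{P})$ be a finite colored poset with a fixed chain partition and $s\ge0$. If $D_s$ contains an arc from $p\in P$ to $p'\in P$, then $D_{s+1}$ also contains an arc from $p$ to $p'$ with the same label. In other words, disregarding vertex labels, $D_s$ is a spanning subdigraph of $D_{s+1}$.
   Context: $\mathcal{P}$ is colored by $\lambda:P\to\Lambda$ ($\Lambda$ finite) and has a chain partition $(C_1,\dots,C_w)$; $C(p)=C_j$ for $p\in C_j$. Digraphs may have labeled vertices and arcs and parallel arcs; $R^D_r(v_1,\dots,v_k)$ is the set of vertices reachable in $D$ from some $v_i$ by a directed path of length at most $r$. Put $r_s=3\cdot4^s-1$. Let $\tau_0(p)=\langle\lambda(p),j\rangle$ where $C(p)=C_j$. Given $\tau_s$, $D_s$ is the digraph on $P$ with vertex labels $\tau_s$ and arcs: for every $p\in P$ and $j\in\{1,\dots,w\}$, an arc labeled 'max' from $p$ to the topmost element of $C_j$, an arc labeled 'min' from $p$ to the bottommost element of $C_j$, and for every value $t\in\{\tau_s(q):q\in C_j\}$ an arc labeled 'up' from $p$ to the bottommost $p'\in C_j$ with $p'\ne p$, $\tau_s(p')=t$, $p\leq^\mathcal{P}p'$ (if it exists) and an arc labeled 'down' from $p$ to the topmost $p'\in C_j$ with $p'\ne p$, $\tau_s(p')=t$, $p'\leq^\mathcal{P}p$ (if it exists). Let $P_s(p)=R^{D_s}_{r_s}(p)$ and $\mathcal{A}_s(p)$ the structure formed by the vertex- and arc-labeled induced subdigraph $D_s[P_s(p)]$ rooted at $p$ with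 $\leq^\mathcal{P}$ restricted to $P_s(p)$; $\tau_{s+1}(p)$ is the isomorphism type of $\mathcal{A}_s(p)$. -}

module Defs where

open import Data.Nat using (ℕ; zero; suc; _*_; _^_; _∸_)
open import Data.Fin using (Fin)
open import Data.Product using (Σ; ∃; _×_; _,_)
open import Data.Sum using (_⊎_)
open import Relation.Binary.PropositionalEquality using (_≡_; _≢_)
open import Relation.Binary.Structures using (IsPartialOrder)
open import Function.Bundles using (_⇔_)

-- A finite colored poset P = Fin n with a fixed chain partition (C_1,...,C_w):
-- C_j = { p | chain p ≡ j }.  Colors λ : P → Λ with Λ = Fin m finite.
record ColoredChainPoset : Set₁ where
  field
    n              : ℕ
    _≤P_           : Fin n → Fin n → Set
    isPartialOrder : IsPartialOrder _≡_ _≤P_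
    m              : ℕ
    color          : Fin n → Fin m
    w              : ℕ
    chain          : Fin n → Fin w
    chain-isChain  : ∀ p q → chain p ≡ chain q → (p ≤P q) ⊎ (q ≤P p)
    chain-nonempty : ∀ (j : Fin w) → ∃ λ p → chain p ≡ j

data ArcLabel : Set where
  max min up down : ArcLabel

r : ℕ → ℕ
r s = 3 * 4 ^ s ∸ 1

module Construction (𝒫 : ColoredChainPoset) where
  open ColoredChainPoset 𝒫

  P : Set
  P = Fin n

  -- The arcs of the digraph determined by a vertex labelling τ, where the
  -- labelling is given through its kernel E (E x y  ⟺  τ x = τ y).
  -- A value t ∈ {τ(q) : q ∈ C_j} is represented by a witness q with chain q ≡ j.
  Arc : (P → P → Set) → P → ArcLabel → P → Set
  Arc E p max p'  = ∀ q → chain q ≡ chain p' → q ≤P p'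
  Arc E p min p'  = ∀ q → chain q ≡ chain p' → p' ≤P q
  Arc E p up p'   = ∃ λ t → chain p' ≡ chain t × p' ≢ p × E p' t × p ≤P p'
                      × (∀ p'' → chain p'' ≡ chain t → p'' ≢ p → E p'' t → p ≤P p'' → p' ≤P p'')
  Arc E p down p' = ∃ λ t → chain p' ≡ chain t × p' ≢ p × E p' t × p' ≤P p
                      × (∀ p'' → chain p'' ≡ chain t → p'' ≢ p → E p'' t → p'' ≤P p → p'' ≤P p')

  data Reach (A : P → ArcLabel → P → Set) (p : P) : ℕ → P → Set where
    here : ∀ {k} → Reach A p k p
    step : ∀ {k x y ℓ} → Reach A p k x → A x ℓ y → Reach A p (suc k) y

  -- Isomorphism of the rooted structures A(p) and A(q): the vertex- and
  -- arc-labelled induced subdigraphs on the k-balls around p and q, rooted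
  -- at p and q, together with the restricted partial order.
  record Iso (E : P → P → Set) (k : ℕ) (p q : P) : Set where
    field
      f g   : P → P
      f-in  : ∀ x → Reach (Arc E) p k x → Reach (Arc E) q k (f x)
      g-in  : ∀ y → Reach (Arc E) q k y → Reach (Arc E) p k (g y)
      gf    : ∀ x → Reach (Arc E) p k x → g (f x) ≡ x
      fg    : ∀ y → Reach (Arc E) q k y → f (g y) ≡ y
      root  : f p ≡ q
      label : ∀ x → Reach (Arc E) p k x → E x (f x)
      order : ∀ x y → Reach (Arc E) p k x → Reach (Arc E) p k y →
              (x ≤P y) ⇔ (f x ≤P f y)
      arcs  : ∀ x y ℓ → Reach (Arc E) p k x → Reach (Arc E) p k y →
              Arc E x ℓ y ⇔ Arc E (f x) ℓ (f y)

  -- Kernel of τ_s:  SameType s p q  ⟺  τ_s p = τ_s q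
  SameType : ℕ → P → P → Set
  SameType zero    p q = (color p ≡ color q) × (chain p ≡ chain q)
  SameType (suc s) p q = Iso (SameType s) (r s) p q

  D : ℕ → P → ArcLabel → P → Set
  D s = Arc (SameType s)

-- The arcs of D_s depend on the vertex labelling τ_s only through its kernel
-- E_s (x E_s y ⟺ τ_s x = τ_s y).  'max'/'min' arcs do not look at τ at all,
-- and an 'up'/'down' arc to p' is the extremal element among the candidates of
-- one τ-class.  The proof has two parts:
--   * arc-refine: if E' is reflexive and refines a transitive relation E,
--     every arc for E is an arc for E'.  Indeed the E'-class of p' itself
--     witnesses the arc: its candidates are E-candidates of the original
--     class, among which p' is already extremal.
--   * τ_{s+1} refines τ_s: an isomorphism of the rooted structures A_s(x)
--     and A_s(y) maps the root x to y and preserves τ_s.  Reflexivity and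
--     transitivity of every E_s follow from identity and composition of
--     isomorphisms.
module Submission where

open import Defs
open import Data.Nat using (ℕ; suc; zero)
open import Data.Fin using (Fin)
open import Data.Product using (_,_)
open import Relation.Binary.PropositionalEquality using (_≡_; refl; trans; cong; subst)
import Function.Properties.Equivalence as ⇔

module _ (𝒫 : ColoredChainPoset) where
  open ColoredChainPoset 𝒫
  open Construction 𝒫

  arc-refine : {E E' : P → P → Set} →
               (∀ x → E' x x) → (∀ {x y} → E' x y → E x y) →
               (∀ {x y z} → E x y → E y z → E x z) →
               ∀ p ℓ p' → Arc E p ℓ p' → Arc E' p ℓ p'
  arc-refine refl' refines trans-E p max  p' top    = top
  arc-refine refl' refines trans-E p min  p' bottom = bottom
  arc-refine refl' refines trans-E p up   p' (t , p'∈C , p'≢p , p'Et , p≤p' , least) =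
    p' , refl , p'≢p , refl' p' , p≤p' ,
    λ q q∈C q≢p qE'p' p≤q → least q (trans q∈C p'∈C) q≢p (trans-E (refines qE'p') p'Et) p≤q
  arc-refine refl' refines trans-E p down p' (t , p'∈C , p'≢p , p'Et , p'≤p , greatest) =
    p' , refl , p'≢p , refl' p' , p'≤p ,
    λ q q∈C q≢p qE'p' q≤p → greatest q (trans q∈C p'∈C) q≢p (trans-E (refines qE'p') p'Et) q≤p

  iso-refl : {E : P → P → Set} → (∀ x → E x x) → ∀ k p → Iso E k p p
  iso-refl reflexive k p = record
    { f = λ x → x ; g = λ x → x
    ; f-in = λ x h → h ; g-in = λ y h → h
    ; gf = λ x h → refl ; fg = λ y h → refl ; root = refl
    ; label = λ x h → reflexive x
    ; order = λ x y hx hy → ⇔.refl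
    ; arcs = λ x y ℓ hx hy → ⇔.refl }

  iso-trans : {E : P → P → Set} → (∀ {x y z} → E x y → E y z → E x z) →
              ∀ k {p q u} → Iso E k p q → Iso E k q u → Iso E k p u
  iso-trans transitive k i j = record
    { f = λ x → J.f (I.f x) ; g = λ y → I.g (J.g y)
    ; f-in = λ x h → J.f-in (I.f x) (I.f-in x h)
    ; g-in = λ y h → I.g-in (J.g y) (J.g-in y h)
    ; gf = λ x h → trans (cong I.g (J.gf (I.f x) (I.f-in x h))) (I.gf x h)
    ; fg = λ y h → trans (cong J.f (I.fg (J.g y) (J.g-in y h))) (J.fg y h)
    ; root = trans (cong J.f I.root) J.root
    ; label = λ x h → transitive (I.label x h) (J.label (I.f x) (I.f-in x h))
    ; order = λ x y hx hy →
        ⇔.trans (I.order x y hx hy) (J.order (I.f x) (I.f y) (I.f-in x hx) (I.f-in y hy))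
    ; arcs = λ x y ℓ hx hy →
        ⇔.trans (I.arcs x y ℓ hx hy) (J.arcs (I.f x) (I.f y) ℓ (I.f-in x hx) (I.f-in y hy)) }
    where
      module I = Iso i
      module J = Iso j

  sameType-refl : ∀ s x → SameType s x x
  sameType-refl zero    x = refl , refl
  sameType-refl (suc s) x = iso-refl (sameType-refl s) (r s) x

  sameType-trans : ∀ s {x y z} → SameType s x y → SameType s y z → SameType s x z
  sameType-trans zero    (c₁ , j₁) (c₂ , j₂) = trans c₁ c₂ , trans j₁ j₂
  sameType-trans (suc s) i j = iso-trans (sameType-trans s) (r s) i j

  sameType-refines : ∀ s {x y} → SameType (suc s) x y → SameType s x y
  sameType-refines s {x} i = subst (SameType s x) (Iso.root i) (Iso.label i x here)

lemma3p3 : (𝒫 : ColoredChainPoset) (s : ℕ) (p p' : Fin (ColoredChainPoset.n 𝒫)) (ℓ : ArcLabel) →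
    Construction.D 𝒫 s p ℓ p' → Construction.D 𝒫 (suc s) p ℓ p'
lemma3p3 𝒫 s p p' ℓ =
  arc-refine 𝒫 (sameType-refl 𝒫 (suc s)) (sameType-refines 𝒫 s) (sameType-trans 𝒫 s) p ℓ p'
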